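{- Let $G=K_4-e$ be the graph obtained from the complete graph $K_4$ by deleting one edge. Then $pd(G)=2$. Furthermore, for every edge-coloring of $G$ with $2$ colors that makes $G$ proper disconnected, the two edges of each perfect matching of $G$ receive the same color.
   Context: All graphs are simple, finite and undirected. For an edge-coloring $c$ of a graph $G$, a set $F\subseteq E(G)$ is a proper cut if $G-F$ is disconnected and any two edges of $F$ sharing an endpoint receive different colors. A proper cut $F$ separates two vertices $x,y$ if $x$ and $y$ lie in different components of $G-F$. An edge-colored graph is proper disconnected if for every pair of distinct vertices there is a proper cut separating them. For a connected graph $G$, the proper disconnection number $pd(G)$ is the minimum $k$ such that there is an edge-coloring $c:E(G)\to\{1,\dots,k\}$ making $G$ proper disconnected. -}

module Defs where

open import Data.Nat using (ℕ; _<_)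
open import Data.Fin using (Fin; zero; suc)
open import Data.Bool using (Bool; true; false; _∧_; not)
open import Data.Product using (Σ; _×_; ∃; ∃-syntax)
open import Relation.Binary.PropositionalEquality using (_≡_; _≢_)
open import Relation.Nullary using (¬_)

record Graph (n : ℕ) : Set where
  field
    adj    : Fin n → Fin n → Bool
    sym    : ∀ x y → adj x y ≡ adj y x
    irrefl : ∀ x → adj x x ≡ false
open Graph public

data Reach {n : ℕ} (a : Fin n → Fin n → Bool) : Fin n → Fin n → Set where
  here : ∀ {x} → Reach a x x
  step : ∀ {x z y} → a x z ≡ true → Reach a z y → Reach a x y

Connected : ∀ {n} → Graph n → Set
Connected G = ∀ x y → Reach (adj G) x y

-- An edge-coloring with colors Fin k: a color for every unordered pair
-- (symmetric); only values on edges of G matter.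
record Coloring {n : ℕ} (G : Graph n) (k : ℕ) : Set where
  field
    col     : Fin n → Fin n → Fin k
    col-sym : ∀ x y → col x y ≡ col y x
open Coloring public

record EdgeSet {n : ℕ} (G : Graph n) : Set where
  field
    mem     : Fin n → Fin n → Bool
    mem-sym : ∀ x y → mem x y ≡ mem y x
    mem-adj : ∀ x y → mem x y ≡ true → adj G x y ≡ true
open EdgeSet public

delete : ∀ {n} (G : Graph n) → EdgeSet G → Fin n → Fin n → Bool
delete G F x y = adj G x y ∧ not (mem F x y)

Disconnected : ∀ {n} → (Fin n → Fin n → Bool) → Set
Disconnected {n} a = Σ (Fin n) λ x → Σ (Fin n) λ y → ¬ Reach a x y

ProperlyColored : ∀ {n k} {G : Graph n} → Coloring G k → EdgeSet G → Set
ProperlyColored {n} c F =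
  ∀ (u v w : Fin n) → v ≢ w → mem F u v ≡ true → mem F u w ≡ true →
  col c u v ≢ col c u w

ProperCut : ∀ {n k} {G : Graph n} → Coloring G k → EdgeSet G → Set
ProperCut {G = G} c F = Disconnected (delete G F) × ProperlyColored c F

Separates : ∀ {n} {G : Graph n} → EdgeSet G → Fin n → Fin n → Set
Separates {G = G} F x y = ¬ Reach (delete G F) x y

ProperDisconnected : ∀ {n k} {G : Graph n} → Coloring G k → Set
ProperDisconnected {n} {G = G} c =
  ∀ (x y : Fin n) → x ≢ y →
  Σ (EdgeSet G) λ F → ProperCut c F × Separates F x y

PdEquals : ∀ {n} → Graph n → ℕ → Set
PdEquals G m =
  Connected G
  × Σ (Coloring G m) ProperDisconnected
  × (∀ k → k < m → (c : Coloring G k) → ¬ ProperDisconnected c)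

PerfectMatching : ∀ {n} {G : Graph n} → EdgeSet G → Set
PerfectMatching {n} M =
  ∀ (x : Fin n) → Σ (Fin n) λ y → mem M x y ≡ true ×
     (∀ z → mem M x z ≡ true → z ≡ y)

-- K4 - e on vertices 0,1,2,3 with the edge 01 deleted.
k4e-adj : Fin 4 → Fin 4 → Bool
k4e-adj zero zero = false
k4e-adj zero (suc zero) = false
k4e-adj (suc zero) zero = false
k4e-adj (suc zero) (suc zero) = false
k4e-adj (suc (suc zero)) (suc (suc zero)) = false
k4e-adj (suc (suc (suc zero))) (suc (suc (suc zero))) = false
k4e-adj _ _ = true

k4e-sym : ∀ x y → k4e-adj x y ≡ k4e-adj y x
k4e-sym zero zero = _≡_.refl
k4e-sym zero (suc zero) = _≡_.refl
k4e-sym zero (suc (suc zero)) = _≡_.refl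
k4e-sym zero (suc (suc (suc zero))) = _≡_.refl
k4e-sym (suc zero) zero = _≡_.refl
k4e-sym (suc zero) (suc zero) = _≡_.refl
k4e-sym (suc zero) (suc (suc zero)) = _≡_.refl
k4e-sym (suc zero) (suc (suc (suc zero))) = _≡_.refl
k4e-sym (suc (suc zero)) zero = _≡_.refl
k4e-sym (suc (suc zero)) (suc zero) = _≡_.refl
k4e-sym (suc (suc zero)) (suc (suc zero)) = _≡_.refl
k4e-sym (suc (suc zero)) (suc (suc (suc zero))) = _≡_.refl
k4e-sym (suc (suc (suc zero))) zero = _≡_.refl
k4e-sym (suc (suc (suc zero))) (suc zero) = _≡_.refl
k4e-sym (suc (suc (suc zero))) (suc (suc zero)) = _≡_.refl
k4e-sym (suc (suc (suc zero))) (suc (suc (suc zero))) = _≡_.refl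

k4e-irrefl : ∀ x → k4e-adj x x ≡ false
k4e-irrefl zero = _≡_.refl
k4e-irrefl (suc zero) = _≡_.refl
k4e-irrefl (suc (suc zero)) = _≡_.refl
k4e-irrefl (suc (suc (suc zero))) = _≡_.refl

K4-e : Graph 4
K4-e = record { adj = k4e-adj ; sym = k4e-sym ; irrefl = k4e-irrefl }

-- For K4 - e: a 1-colouring traps a diamond, so
-- pd ≥ 2; an explicit 2-colouring with boundary cuts gives pd ≤ 2.  For a
-- proper-disconnecting 2-colouring, a cut separating 2 from 3 makes one
-- perfect matching monochromatic, and the other is too since otherwise a
-- diamond is trapped; the perfect matchings are exactly these two.
module Submission where

open import Defs
open import Data.Fin using (Fin)
open import Data.Product using (_×_)
open import Data.Bool using (true)
open import Relation.Binary.PropositionalEquality using (_≡_)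

open import Data.Nat using (ℕ; _<_; s≤s; 2+)
open import Data.Fin using (zero; suc; _≟_)
open import Data.Fin.Properties using (all?)
open import Data.Bool using (Bool; false; _∧_; not; _xor_)
import Data.Bool as Bool
open import Data.Bool.Properties using (xor-comm)
open import Data.Product using (Σ; _,_; proj₁; proj₂)
open import Data.Sum using (_⊎_; inj₁; inj₂)
open import Data.Empty using (⊥; ⊥-elim)
open import Relation.Nullary using (¬_; yes; no)
open import Relation.Nullary.Decidable using (Dec; ¬?; _→-dec_; toWitness)
open import Relation.Binary.PropositionalEquality
  using (_≢_; ≢-sym; refl; trans; cong₂)
  renaming (sym to ≡-sym)

module _ {n : ℕ} {G : Graph n} where

  adjacent-distinct : ∀ {x y} → adj G x y ≡ true → x ≢ y
  adjacent-distinct {x} xy refl with trans (≡-sym (irrefl G x)) xy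
  ... | ()

  dominated-connected : (h : Fin n) → (∀ x → x ≢ h → adj G x h ≡ true) →
                        Connected G
  dominated-connected h dom x y = join (to-hub x) (from-hub y)
    where
    to-hub : ∀ x → Reach (adj G) x h
    to-hub x with x ≟ h
    ... | yes refl = here
    ... | no x≢h   = step (dom x x≢h) here

    from-hub : ∀ y → Reach (adj G) h y
    from-hub y with y ≟ h
    ... | yes refl = here
    ... | no y≢h   = step (trans (Graph.sym G h y) (dom y y≢h)) here

    join : ∀ {x z y} → Reach (adj G) x z → Reach (adj G) z y →
           Reach (adj G) x y
    join here         q = q
    join (step e p) q = step e (join p q)

  cut-blocks : ∀ (F : EdgeSet G) {x y z} → Separates F x y →
               adj G x z ≡ true → mem F x z ≡ true ⊎ Separates F z y
  cut-blocks F {x} {z = z} sep xz with mem F x z in xz∈F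
  ... | true  = inj₁ refl
  ... | false = inj₂ λ z⇝y → sep (step kept z⇝y)
    where
    kept : delete G F x z ≡ true
    kept rewrite xz | xz∈F = refl

  cut-contains-edge : ∀ (F : EdgeSet G) {x y} → Separates F x y →
                      adj G x y ≡ true → mem F x y ≡ true
  cut-contains-edge F sep xy with cut-blocks F sep xy
  ... | inj₁ xy∈F  = xy∈F
  ... | inj₂ sep′  = ⊥-elim (sep′ here)

  inseparable : ∀ {k} (c : Coloring G k) {x y} → x ≢ y →
                (∀ F → ProperlyColored c F → ¬ Separates F x y) →
                ¬ ProperDisconnected c
  inseparable c x≢y stuck pd with pd _ _ x≢y
  ... | F , (_ , proper) , sep = stuck F proper sep

  -- A proper cut separating u
  -- from t contains ut, hence not um, so it separates m from t; then it
  -- contains mt, hence not mo, so it separates o from t; then it contains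
  -- ot, which clashes with ut at t.
  trapped-diamond :
    ∀ {k} (c : Coloring G k) {u m t o} →
    adj G u t ≡ true → adj G u m ≡ true → adj G m t ≡ true →
    adj G m o ≡ true → adj G o t ≡ true → o ≢ u →
    col c u m ≡ col c u t → col c m t ≡ col c m o → col c o t ≡ col c u t →
    ∀ F → ProperlyColored c F → ¬ Separates F u t
  trapped-diamond c {u} {m} {t} {o} ut um mt mo ot o≢u um=ut mt=mo ot=ut
                  F proper sep-ut
    with cut-blocks F sep-ut um
  ... | inj₁ um∈F = proper u m t (adjacent-distinct mt) um∈F ut∈F um=ut
    where
    ut∈F : mem F u t ≡ true
    ut∈F = cut-contains-edge F sep-ut ut
  ... | inj₂ sep-mt with cut-blocks F sep-mt mo
  ...   | inj₁ mo∈F =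
    proper m t o (adjacent-distinct (trans (Graph.sym G t o) ot))
           (cut-contains-edge F sep-mt mt) mo∈F mt=mo
  ...   | inj₂ sep-ot =
    proper t o u o≢u (oriented o t (cut-contains-edge F sep-ot ot))
                     (oriented u t (cut-contains-edge F sep-ut ut))
           (trans (col-sym c t o) (trans ot=ut (col-sym c u t)))
    where
    oriented : ∀ a b → mem F a b ≡ true → mem F b a ≡ true
    oriented a b ab∈F = trans (mem-sym F b a) ab∈F

  properly-coloured? : ∀ {k} (c : Coloring G k) (F : EdgeSet G) →
                       Dec (ProperlyColored c F)
  properly-coloured? c F =
    all? λ u → all? λ v → all? λ w →
      ¬? (v ≟ w) →-dec (mem F u v Bool.≟ true) →-dec
      (mem F u w Bool.≟ true) →-dec ¬? (col c u v ≟ col c u w)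

  boundary : (Fin n → Bool) → EdgeSet G
  boundary S = record
    { mem     = λ x y → adj G x y ∧ (S x xor S y)
    ; mem-sym = λ x y → cong₂ _∧_ (Graph.sym G x y) (xor-comm (S x) (S y))
    ; mem-adj = λ x y → adj-of
    }
    where
    adj-of : ∀ {a b} → a ∧ b ≡ true → a ≡ true
    adj-of {true} _ = refl

  -- Side of S is invariant along G - δ(S), so δ(S) separates S from its
  -- complement.
  boundary-separates : (S : Fin n → Bool) → ∀ {x y} → S x ≢ S y →
                       Separates (boundary S) x y
  boundary-separates S S-differ x⇝y = S-differ (same-side x⇝y)
    where
    kept-same-side : ∀ a s t → a ∧ not (a ∧ (s xor t)) ≡ true → s ≡ t
    kept-same-side true true  true  _ = refl
    kept-same-side true false false _ = refl

    same-side : ∀ {x y} → Reach (delete G (boundary S)) x y → S x ≡ S y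
    same-side here = refl
    same-side (step {x} {z} xz z⇝y) =
      trans (kept-same-side (adj G x z) (S x) (S z) xz) (same-side z⇝y)

  boundary-proper-cut :
    ∀ {k} (c : Coloring G k) (S : Fin n → Bool) →
    ProperlyColored c (boundary S) → ∀ {x y} → S x ≢ S y →
    ProperCut c (boundary S) × Separates (boundary S) x y
  boundary-proper-cut c S proper S-differ =
    (( _ , _ , boundary-separates S S-differ) , proper)
    , boundary-separates S S-differ

  matching-unique : (M : EdgeSet G) → PerfectMatching M → ∀ {x y z} →
                    mem M x y ≡ true → mem M x z ≡ true → y ≡ z
  matching-unique M perfect {x} xy∈M xz∈M =
    trans (partner-unique _ xy∈M) (≡-sym (partner-unique _ xz∈M))
    where
    partner-unique : ∀ z → mem M x z ≡ true → z ≡ proj₁ (perfect x)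
    partner-unique = proj₂ (proj₂ (perfect x))

  matching-monochromatic :
    ∀ {k} (c : Coloring G k) (M : EdgeSet G) → PerfectMatching M → ∀ κ →
    (∀ x → Σ (Fin n) λ y → mem M x y ≡ true × col c x y ≡ κ) →
    ∀ a b → mem M a b ≡ true → col c a b ≡ κ
  matching-monochromatic c M perfect κ coloured a b ab∈M
    with coloured a
  ... | y , ay∈M , ay-colour with matching-unique M perfect ab∈M ay∈M
  ...   | refl = ay-colour

two-colours : ∀ {a b c : Fin 2} → a ≢ c → b ≢ c → a ≡ b
two-colours {zero}     {zero}     _   _   = refl
two-colours {suc zero} {suc zero} _   _   = refl
two-colours {zero}     {suc zero} {zero}     a≢c _   = ⊥-elim (a≢c refl)
two-colours {zero}     {suc zero} {suc zero} _   b≢c = ⊥-elim (b≢c refl)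
two-colours {suc zero} {zero}     {zero}     _   b≢c = ⊥-elim (b≢c refl)
two-colours {suc zero} {zero}     {suc zero} a≢c _   = ⊥-elim (a≢c refl)

pattern v0 = zero
pattern v1 = suc zero
pattern v2 = suc (suc zero)
pattern v3 = suc (suc (suc zero))

K4-e-connected : Connected K4-e
K4-e-connected = dominated-connected {G = K4-e} v2 dominated
  where
  dominated : ∀ x → x ≢ v2 → k4e-adj x v2 ≡ true
  dominated v0 _   = refl
  dominated v1 _   = refl
  dominated v2 2≢2 = ⊥-elim (2≢2 refl)
  dominated v3 _   = refl

one-colour-fails : (c : Coloring K4-e 1) → ¬ ProperDisconnected c
one-colour-fails c =
  inseparable c {v0} {v3} (λ ())
    (trapped-diamond c {m = v2} {o = v1} refl refl refl refl refl
    (λ ()) (same _ _) (same _ _) (same _ _))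
  where
  same : (a b : Fin 1) → a ≡ b
  same zero zero = refl

-- With no colours there is no colouring at all (K4 - e has an edge), and
-- with one colour some diamond is trapped.
fewer-colours-fail : ∀ k → k < 2 → (c : Coloring K4-e k) →
                     ¬ ProperDisconnected c
fewer-colours-fail 0 _ c _ with col c v0 v2
... | ()
fewer-colours-fail 1 _ c = one-colour-fails c
fewer-colours-fail (2+ _) (s≤s (s≤s ()))

witness : Coloring K4-e 2
witness = record { col = colour ; col-sym = colour-sym }
  where
  colour : Fin 4 → Fin 4 → Fin 2
  colour v0 v3 = suc zero
  colour v3 v0 = suc zero
  colour v1 v2 = suc zero
  colour v2 v1 = suc zero
  colour _  _  = zero

  colour-sym : ∀ x y → colour x y ≡ colour y x
  colour-sym v0 v0 = refl
  colour-sym v0 v1 = refl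
  colour-sym v0 v2 = refl
  colour-sym v0 v3 = refl
  colour-sym v1 v0 = refl
  colour-sym v1 v1 = refl
  colour-sym v1 v2 = refl
  colour-sym v1 v3 = refl
  colour-sym v2 v0 = refl
  colour-sym v2 v1 = refl
  colour-sym v2 v2 = refl
  colour-sym v2 v3 = refl
  colour-sym v3 v0 = refl
  colour-sym v3 v1 = refl
  colour-sym v3 v2 = refl
  colour-sym v3 v3 = refl

only-0 only-1 only-02 : Fin 4 → Bool
only-0 v0 = true
only-0 _  = false
only-1 v1 = true
only-1 _  = false
only-02 v0 = true
only-02 v2 = true
only-02 _  = false

only-0-proper : ProperlyColored witness (boundary only-0)
only-0-proper = toWitness {a? = properly-coloured? witness (boundary only-0)} _

only-1-proper : ProperlyColored witness (boundary only-1)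
only-1-proper = toWitness {a? = properly-coloured? witness (boundary only-1)} _

only-02-proper : ProperlyColored witness (boundary only-02)
only-02-proper =
  toWitness {a? = properly-coloured? witness (boundary only-02)} _

witness-proper-disconnected : ProperDisconnected witness
witness-proper-disconnected x y x≢y with separator x y x≢y
  where
  separator : ∀ x y → x ≢ y →
              Σ (Fin 4 → Bool) λ S →
                ProperlyColored witness (boundary S) × S x ≢ S y
  separator v0 v1 _ = only-0  , only-0-proper  , λ ()
  separator v0 v2 _ = only-0  , only-0-proper  , λ ()
  separator v0 v3 _ = only-0  , only-0-proper  , λ ()
  separator v1 v0 _ = only-0  , only-0-proper  , λ ()
  separator v2 v0 _ = only-0  , only-0-proper  , λ ()
  separator v3 v0 _ = only-0  , only-0-proper  , λ ()
  separator v1 v2 _ = only-1  , only-1-proper  , λ ()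
  separator v1 v3 _ = only-1  , only-1-proper  , λ ()
  separator v2 v1 _ = only-1  , only-1-proper  , λ ()
  separator v3 v1 _ = only-1  , only-1-proper  , λ ()
  separator v2 v3 _ = only-02 , only-02-proper , λ ()
  separator v3 v2 _ = only-02 , only-02-proper , λ ()
  separator v0 v0 0≢0 = ⊥-elim (0≢0 refl)
  separator v1 v1 1≢1 = ⊥-elim (1≢1 refl)
  separator v2 v2 2≢2 = ⊥-elim (2≢2 refl)
  separator v3 v3 3≢3 = ⊥-elim (3≢3 refl)
... | S , proper , S-differ =
  boundary S , boundary-proper-cut witness S proper S-differ

module TwoColouring (c : Coloring K4-e 2) where

  κ : Fin 4 → Fin 4 → Fin 2
  κ = col c

  -- A proper cut separating 2 from 3 contains 23, one of 20/30 and one of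
  -- 21/31.  Each of these meets 23, so has the colour other than κ23; two of
  -- them at a common vertex would then clash, leaving {02,13} or {03,12}.
  cut-2-3 : ∀ F → ProperlyColored c F → Separates F v2 v3 →
            (κ v0 v2 ≡ κ v1 v3 × κ v0 v2 ≢ κ v2 v3)
            ⊎ (κ v0 v3 ≡ κ v1 v2 × κ v0 v3 ≢ κ v2 v3)
  cut-2-3 F proper sep =
    cases (blocked v0 refl (cut-blocks F sep refl))
          (blocked v1 refl (cut-blocks F sep refl))
    where
    23∈F : mem F v2 v3 ≡ true
    23∈F = cut-contains-edge F sep refl

    blocked : ∀ x → k4e-adj x v3 ≡ true →
              mem F v2 x ≡ true ⊎ Separates F x v3 →
              mem F v2 x ≡ true ⊎ mem F v3 x ≡ true
    blocked x _    (inj₁ 2x∈F) = inj₁ 2x∈F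
    blocked x x-3 (inj₂ sep′) =
      inj₂ (trans (mem-sym F v3 x) (cut-contains-edge F sep′ x-3))

    at-2 : ∀ x → x ≢ v3 → mem F v2 x ≡ true → κ x v2 ≢ κ v2 v3
    at-2 x x≢3 2x∈F same =
      proper v2 x v3 x≢3 2x∈F 23∈F (trans (col-sym c v2 x) same)

    at-3 : ∀ x → x ≢ v2 → mem F v3 x ≡ true → κ x v3 ≢ κ v2 v3
    at-3 x x≢2 3x∈F same =
      proper v3 x v2 x≢2 3x∈F (trans (mem-sym F v3 v2) 23∈F)
        (trans (col-sym c v3 x) (trans same (col-sym c v2 v3)))

    cases : mem F v2 v0 ≡ true ⊎ mem F v3 v0 ≡ true →
            mem F v2 v1 ≡ true ⊎ mem F v3 v1 ≡ true →
            (κ v0 v2 ≡ κ v1 v3 × κ v0 v2 ≢ κ v2 v3)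
            ⊎ (κ v0 v3 ≡ κ v1 v2 × κ v0 v3 ≢ κ v2 v3)
    cases (inj₁ 20∈F) (inj₂ 31∈F) =
      inj₁ (two-colours (at-2 v0 (λ ()) 20∈F) (at-3 v1 (λ ()) 31∈F)
           , at-2 v0 (λ ()) 20∈F)
    cases (inj₂ 30∈F) (inj₁ 21∈F) =
      inj₂ (two-colours (at-3 v0 (λ ()) 30∈F) (at-2 v1 (λ ()) 21∈F)
           , at-3 v0 (λ ()) 30∈F)
    cases (inj₁ 20∈F) (inj₁ 21∈F) =
      ⊥-elim (proper v2 v0 v1 (λ ()) 20∈F 21∈F
        (trans (col-sym c v2 v0)
          (trans (two-colours (at-2 v0 (λ ()) 20∈F) (at-2 v1 (λ ()) 21∈F))
                 (col-sym c v1 v2))))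
    cases (inj₂ 30∈F) (inj₂ 31∈F) =
      ⊥-elim (proper v3 v0 v1 (λ ()) 30∈F 31∈F
        (trans (col-sym c v3 v0)
          (trans (two-colours (at-3 v0 (λ ()) 30∈F) (at-3 v1 (λ ()) 31∈F))
                 (col-sym c v1 v3))))

  -- If {02,13} is monochromatic with a colour other than κ23, so is {03,12}:
  -- otherwise the diamond 0,2,3,1 or the diamond 1,3,2,0 is trapped.
  second-matching-02 : ProperDisconnected c →
                       κ v0 v2 ≡ κ v1 v3 → κ v0 v2 ≢ κ v2 v3 →
                       κ v0 v3 ≡ κ v1 v2
  second-matching-02 pd 02=13 02≢23 with κ v0 v3 ≟ κ v1 v2
  ... | yes 03=12 = 03=12
  ... | no 03≢12 with κ v0 v3 ≟ κ v0 v2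
  ...   | yes 03=02 =
    ⊥-elim (inseparable c {v0} {v3} (λ ())
      (trapped-diamond c {m = v2} {o = v1} refl refl refl refl refl (λ ())
        (≡-sym 03=02)
        (trans (≡-sym 12=23) (col-sym c v1 v2))
        (trans (≡-sym 02=13) (≡-sym 03=02)))
      pd)
    where
    12=23 : κ v1 v2 ≡ κ v2 v3
    12=23 = two-colours (λ 12=02 → 03≢12 (trans 03=02 (≡-sym 12=02)))
                        (≢-sym 02≢23)
  ...   | no 03≢02 =
    ⊥-elim (inseparable c {v1} {v2} (λ ())
      (trapped-diamond c {m = v3} {o = v0} refl refl refl refl refl (λ ())
        (trans (≡-sym 02=13) (≡-sym 12=02))
        (trans (col-sym c v3 v2) (trans (≡-sym 03=23) (col-sym c v0 v3)))
        (≡-sym 12=02))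
      pd)
    where
    03=23 : κ v0 v3 ≡ κ v2 v3
    03=23 = two-colours 03≢02 (≢-sym 02≢23)

    12=02 : κ v1 v2 ≡ κ v0 v2
    12=02 = two-colours (λ 12=23 → 03≢12 (trans 03=23 (≡-sym 12=23))) 02≢23

  -- Symmetrically, if {03,12} is monochromatic with a colour other than
  -- κ23, so is {02,13}: otherwise the diamond 0,3,2,1 or 1,2,3,0 is trapped.
  second-matching-03 : ProperDisconnected c →
                       κ v0 v3 ≡ κ v1 v2 → κ v0 v3 ≢ κ v2 v3 →
                       κ v0 v2 ≡ κ v1 v3
  second-matching-03 pd 03=12 03≢23 with κ v0 v2 ≟ κ v1 v3
  ... | yes 02=13 = 02=13
  ... | no 02≢13 with κ v0 v2 ≟ κ v0 v3
  ...   | yes 02=03 =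
    ⊥-elim (inseparable c {v0} {v2} (λ ())
      (trapped-diamond c {m = v3} {o = v1} refl refl refl refl refl (λ ())
        (≡-sym 02=03)
        (trans (col-sym c v3 v2) (trans (≡-sym 13=23) (col-sym c v1 v3)))
        (trans (≡-sym 03=12) (≡-sym 02=03)))
      pd)
    where
    13=23 : κ v1 v3 ≡ κ v2 v3
    13=23 = two-colours (λ 13=03 → 02≢13 (trans 02=03 (≡-sym 13=03)))
                        (≢-sym 03≢23)
  ...   | no 02≢03 =
    ⊥-elim (inseparable c {v1} {v3} (λ ())
      (trapped-diamond c {m = v2} {o = v0} refl refl refl refl refl (λ ())
        (trans (≡-sym 03=12) (≡-sym 13=03))
        (trans (≡-sym 02=23) (col-sym c v0 v2))
        (≡-sym 13=03))
      pd)
    where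
    02=23 : κ v0 v2 ≡ κ v2 v3
    02=23 = two-colours 02≢03 (≢-sym 03≢23)

    13=03 : κ v1 v3 ≡ κ v0 v3
    13=03 = two-colours (λ 13=23 → 02≢13 (trans 02=23 (≡-sym 13=23))) 03≢23

  -- Both perfect matchings are monochromatic: separate 2 from 3, which makes
  -- one of them monochromatic, and conclude for the other as above.
  matchings-monochromatic : ProperDisconnected c →
                            κ v0 v2 ≡ κ v1 v3 × κ v0 v3 ≡ κ v1 v2
  matchings-monochromatic pd with pd v2 v3 (λ ())
  ... | F , (_ , proper) , sep with cut-2-3 F proper sep
  ...   | inj₁ (02=13 , 02≢23) = 02=13 , second-matching-02 pd 02=13 02≢23
  ...   | inj₂ (03=12 , 03≢23) = second-matching-03 pd 03=12 03≢23 , 03=12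

-- The perfect matchings of K4 - e are {02,13} and {03,12}: the partners of
-- 0 and 1 lie in {2,3}, and they differ since 2 and 3 have one partner each.
perfect-matchings : (M : EdgeSet K4-e) → PerfectMatching M →
                    (mem M v0 v2 ≡ true × mem M v1 v3 ≡ true)
                    ⊎ (mem M v0 v3 ≡ true × mem M v1 v2 ≡ true)
perfect-matchings M perfect =
  classify (partner v0) (partner v1)
  where
  partner : ∀ x → Σ (Fin 4) λ y → mem M x y ≡ true
  partner x = proj₁ (perfect x) , proj₁ (proj₂ (perfect x))

  non-edge : false ≡ true → ⊥
  non-edge ()

  shared-partner : ∀ p → mem M v0 p ≡ true → mem M v1 p ≡ true → ⊥
  shared-partner p 0p∈M 1p∈M
    with matching-unique M perfect (trans (mem-sym M p v0) 0p∈M)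
                                   (trans (mem-sym M p v1) 1p∈M)
  ... | ()

  classify : (Σ (Fin 4) λ p → mem M v0 p ≡ true) →
             (Σ (Fin 4) λ q → mem M v1 q ≡ true) →
             (mem M v0 v2 ≡ true × mem M v1 v3 ≡ true)
             ⊎ (mem M v0 v3 ≡ true × mem M v1 v2 ≡ true)
  classify (v2 , 02∈M) (v3 , 13∈M) = inj₁ (02∈M , 13∈M)
  classify (v3 , 03∈M) (v2 , 12∈M) = inj₂ (03∈M , 12∈M)
  classify (v2 , 02∈M) (v2 , 12∈M) = ⊥-elim (shared-partner v2 02∈M 12∈M)
  classify (v3 , 03∈M) (v3 , 13∈M) = ⊥-elim (shared-partner v3 03∈M 13∈M)
  classify (v0 , 00∈M) _ = ⊥-elim (non-edge (mem-adj M v0 v0 00∈M))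
  classify (v1 , 01∈M) _ = ⊥-elim (non-edge (mem-adj M v0 v1 01∈M))
  classify _ (v0 , 10∈M) = ⊥-elim (non-edge (mem-adj M v1 v0 10∈M))
  classify _ (v1 , 11∈M) = ⊥-elim (non-edge (mem-adj M v1 v1 11∈M))

-- In a proper-disconnecting 2-colouring every perfect matching is
-- monochromatic: each vertex meets it in an edge of the common colour.
perfect-matching-monochromatic :
  (c : Coloring K4-e 2) → ProperDisconnected c →
  (M : EdgeSet K4-e) → PerfectMatching M →
  (a b x y : Fin 4) → mem M a b ≡ true → mem M x y ≡ true →
  col c a b ≡ col c x y
perfect-matching-monochromatic c pd M perfect a b x y ab∈M xy∈M =
  trans (monochromatic a b ab∈M) (≡-sym (monochromatic x y xy∈M))
  where
  open TwoColouring c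

  Meets : Fin 2 → Fin 4 → Set
  Meets colour x = Σ (Fin 4) λ y → mem M x y ≡ true × κ x y ≡ colour

  ends : ∀ {u v colour} → mem M u v ≡ true → κ u v ≡ colour →
         Meets colour u × Meets colour v
  ends {u} {v} uv∈M uv-colour =
    (v , uv∈M , uv-colour)
    , (u , trans (mem-sym M v u) uv∈M , trans (col-sym c v u) uv-colour)

  colour-of-M : Σ (Fin 2) λ colour → ∀ x → Meets colour x
  colour-of-M with perfect-matchings M perfect
  ... | inj₁ (02∈M , 13∈M) = κ v0 v2 , meets
    where
    meets : ∀ x → Meets (κ v0 v2) x
    meets v0 = proj₁ (ends 02∈M refl)
    meets v2 = proj₂ (ends 02∈M refl)
    meets v1 = proj₁ (ends 13∈M (≡-sym (proj₁ (matchings-monochromatic pd))))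
    meets v3 = proj₂ (ends 13∈M (≡-sym (proj₁ (matchings-monochromatic pd))))
  ... | inj₂ (03∈M , 12∈M) = κ v0 v3 , meets
    where
    meets : ∀ x → Meets (κ v0 v3) x
    meets v0 = proj₁ (ends 03∈M refl)
    meets v3 = proj₂ (ends 03∈M refl)
    meets v1 = proj₁ (ends 12∈M (≡-sym (proj₂ (matchings-monochromatic pd))))
    meets v2 = proj₂ (ends 12∈M (≡-sym (proj₂ (matchings-monochromatic pd))))

  monochromatic : ∀ a b → mem M a b ≡ true → col c a b ≡ proj₁ colour-of-M
  monochromatic = matching-monochromatic c M perfect
                    (proj₁ colour-of-M) (proj₂ colour-of-M)

lemma3p1 : PdEquals K4-e 2
    × ((c : Coloring K4-e 2) → ProperDisconnected c →
       (M : EdgeSet K4-e) → PerfectMatching M →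
       (a b x y : Fin 4) → mem M a b ≡ true → mem M x y ≡ true →
       col c a b ≡ col c x y)
lemma3p1 =
  ( K4-e-connected
  , (witness , witness-proper-disconnected)
  , fewer-colours-fail )
  , perfect-matching-monochromatic
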